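{- The set of all Sprugnoli arrays $(g,f_1,f_2)$ (with $g\in\mathcal{F}_0$, $f_1\in\mathcal{F}_1$, $f_2\in\mathcal{F}_1$ odd) is closed under the product $$(g,f_1,f_2)\cdot(u,v_1,v_2)=\left(S\cdot u,\ \frac{S\cdot (uv_1)}{S\cdot u},\ \frac{1}{x}\,\frac{S\cdot (x\,u\,v_2)}{S\cdot u}\right),\qquad S=(g,f_1,f_2),$$ and forms a group under this product, with identity element $(1,x,x)$.
   Context: All power series are formal power series over a ground field $\mathbb{K}$ of characteristic $0$ (the paper takes a "suitable" ground ring, e.g. $\mathbb{R}$ or $\mathbb{C}$). For $r\ge 0$, $\mathcal{F}_r$ denotes the set of power series $\sum_{n\ge r}a_nx^n$ with $a_r\neq 0$. A power series is odd if it contains only odd powers of $x$. A Sprugnoli array is a triple $(g,f_1,f_2)$ with $g\in\mathcal{F}_0$, $f_1\in\mathcal{F}_1$, $f_2\in\mathcal{F}_1$ and $f_2$ odd; its matrix is the infinite lower-triangular matrix $T=(t_{n,k})_{n,k\ge0}$ with $t_{n,k}=[x^n]\,g(x)f_1(x)^{k \bmod 2}(xf_2(x))^{\lfloor k/2\rfloor}$. For a power series $h(x)=\sum_n a_nx^n$, the action $(g,f_1,f_2)\cdot h$ is the power series $\sum_{n}\left(\sum_{k} t_{n,k}a_k\right)x^n$ (i.e. the matrix $T$ applied to the coefficient vector of $h$). -}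

module Defs where

open import Level using (Level; _⊔_) renaming (suc to lsuc)
open import Algebra.Bundles using (CommutativeRing)
open import Data.Nat using (ℕ; zero; suc; _∸_; _<_) renaming (_*_ to _*ℕ_)
open import Data.Nat.DivMod using (_/_; _%_)
open import Data.List using (List; []; _∷_; [_]; _++_)
open import Data.Product using (_×_)
open import Relation.Nullary using (¬_)

-- The inverse is given as a (total) operation whose
-- value is only constrained on nonzero elements (as in Mathlib's `Field`).
record Field (c ℓ : Level) : Set (lsuc (c ⊔ ℓ)) where
  field
    commutativeRing : CommutativeRing c ℓ
  open CommutativeRing commutativeRing public
  field
    _⁻¹        : Carrier → Carrier
    ⁻¹-inverse : ∀ x → ¬ (x ≈ 0#) → (x * x ⁻¹) ≈ 1#
    0≉1        : ¬ (0# ≈ 1#)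

fromℕ : ∀ {c ℓ} (K : Field c ℓ) → ℕ → Field.Carrier K
fromℕ K zero    = Field.0# K
fromℕ K (suc n) = Field._+_ K (Field.1# K) (fromℕ K n)

CharZero : ∀ {c ℓ} (K : Field c ℓ) → Set ℓ
CharZero K = ∀ n → ¬ (Field._≈_ K (fromℕ K (suc n)) (Field.0# K))

module Sprugnoli {c ℓ} (K : Field c ℓ) where
  open Field K renaming (_*_ to _·_)

  PS : Set c
  PS = ℕ → Carrier

  _≋_ : PS → PS → Set ℓ
  f ≋ h = ∀ n → f n ≈ h n

  sumTo : ℕ → (ℕ → Carrier) → Carrier
  sumTo zero    a = 0#
  sumTo (suc n) a = sumTo n a + a n

  mulPS : PS → PS → PS
  mulPS f h n = sumTo (suc n) (λ k → f k · h (n ∸ k))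

  onePS : PS
  onePS zero    = 1#
  onePS (suc _) = 0#

  X : PS
  X (suc zero) = 1#
  X _          = 0#

  powPS : PS → ℕ → PS
  powPS f zero    = onePS
  powPS f (suc k) = mulPS f (powPS f k)

  at : List Carrier → ℕ → Carrier
  at []       _       = 0#
  at (a ∷ _)  zero    = a
  at (_ ∷ as) (suc n) = at as n

  invCoeffs : PS → ℕ → List Carrier
  invCoeffs f zero    = [ f 0 ⁻¹ ]
  invCoeffs f (suc n) =
    invCoeffs f n ++ [ - (f 0 ⁻¹ · sumTo (suc n) (λ i → f (suc i) · at (invCoeffs f n) (n ∸ i))) ]

  invPS : PS → PS
  invPS f n = at (invCoeffs f n) n

  divPS : PS → PS → PS
  divPS f h = mulPS f (invPS h)

  -- (1/x)·f  (for f with zero constant term)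
  shiftPS : PS → PS
  shiftPS f n = f (suc n)

  InF : ℕ → PS → Set ℓ
  InF r f = (∀ n → n < r → f n ≈ 0#) × ¬ (f r ≈ 0#)

  Odd : PS → Set ℓ
  Odd f = ∀ n → f (2 *ℕ n) ≈ 0#

  record Triple : Set c where
    constructor ⟨_,_,_⟩
    field
      g  : PS
      f₁ : PS
      f₂ : PS
  open Triple public

  IsSprugnoli : Triple → Set ℓ
  IsSprugnoli T = InF 0 (g T) × InF 1 (f₁ T) × InF 1 (f₂ T) × Odd (f₂ T)

  _≋T_ : Triple → Triple → Set ℓ
  S ≋T T = (g S ≋ g T) × (f₁ S ≋ f₁ T) × (f₂ S ≋ f₂ T)

  column : Triple → ℕ → PS
  column T k = mulPS (g T) (mulPS (powPS (f₁ T) (k % 2)) (powPS (mulPS X (f₂ T)) (k / 2)))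

  entry : Triple → ℕ → ℕ → Carrier
  entry T n k = column T k n

  -- action T · h : coefficient n is Σ_k t_{n,k} a_k; the matrix of a
  -- Sprugnoli array is lower triangular (t_{n,k} = 0 for k > n), so the sum
  -- runs over k ≤ n.
  act : Triple → PS → PS
  act T h n = sumTo (suc n) (λ k → entry T n k · h k)

  _⊙_ : Triple → Triple → Triple
  S ⊙ ⟨ u , v₁ , v₂ ⟩ =
    ⟨ act S u
    , divPS (act S (mulPS u v₁)) (act S u)
    , shiftPS (divPS (act S (mulPS X (mulPS u v₂))) (act S u)) ⟩

  idT : Triple
  idT = ⟨ onePS , X , X ⟩

{-# OPTIONS --safe #-}
-- For a Sprugnoli array S = (g, f₁, f₂) put F = x f₂; since f₂ is odd, F = φ(x²) is even. Splitting
-- h = e(x²) + x o(x²) into even and odd parts, the action reads S·h = g (e ∘ F + f₁ (o ∘ F)), and hence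
-- S·(h Q(x²)) = (Q ∘ F)(S·h) for every series Q. Column k of T = (u, v₁, v₂) is u v₁^(k mod 2) V^⌊k/2⌋
-- with V = x v₂ = W(x²), so this identity shows that column k of S·T is S applied to column k of T:
-- the matrix of S·T is the product of the matrices. An array is recovered from its columns 0, 1, 2,
-- whence associativity and the unit laws. A right inverse (u, w/u, E(x²)/x) comes from solving the
-- triangular systems S·u = 1, S·w = x and E ∘ φ = x, and right inverses in a monoid are two-sided.
module Submission where

open import Defs
open import Data.Product using (_×_; Σ; _,_; proj₁; proj₂)
open import Data.Nat using (ℕ; zero; suc; _∸_; _<_; _≤_; z≤n; s≤s; _≟_)
  renaming (_+_ to _+ℕ_; _*_ to _*ℕ_)
import Data.Nat.Properties as ℕ
open import Data.Nat.DivMod using (_/_; _%_; m/n≡1+[m∸n]/n)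
open import Data.Sum using (inj₁; inj₂)
open import Data.List using (List; []; _∷_; _++_; length)
import Data.List.Properties as List
open import Data.Empty using (⊥-elim)
open import Relation.Nullary using (¬_; yes; no)
open import Relation.Binary.Definitions using (tri<; tri≈; tri>)
open import Relation.Binary.PropositionalEquality as ≡ using (_≡_)
import Relation.Binary.Reasoning.Setoid as SetoidReasoning
open import Relation.Binary.Bundles using (Setoid)
open import Algebra.Bundles using (CommutativeSemiring)
open import Algebra.Structures.Biased using (isCommutativeSemiringˡ)
import Algebra.Solver.Ring.NaturalCoefficients.Default as Solver

double : ℕ → ℕ
double zero    = zero
double (suc m) = suc (suc (double m))

data Parity : ℕ → Set where
  even : ∀ m → Parity (double m)
  odd  : ∀ m → Parity (suc (double m))

parity : ∀ n → Parity n
parity zero = even 0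
parity (suc n) with parity n
... | even m = odd m
... | odd m  = even (suc m)

double≡2* : ∀ m → double m ≡ 2 *ℕ m
double≡2* zero    = ≡.refl
double≡2* (suc m) = ≡.cong suc (≡.trans (≡.cong suc (double≡2* m)) (≡.sym (ℕ.+-suc m (m +ℕ 0))))

double≡*2 : ∀ m → double m ≡ m *ℕ 2
double≡*2 m = ≡.trans (double≡2* m) (ℕ.*-comm 2 m)

n≤double : ∀ n → n ≤ double n
n≤double n = ≡.subst (n ≤_) (≡.sym (double≡2* n)) (ℕ.m≤m+n n (n +ℕ 0))

double-%2 : ∀ m → double m % 2 ≡ 0
double-%2 zero    = ≡.refl
double-%2 (suc m) = double-%2 m

suc-double-%2 : ∀ m → suc (double m) % 2 ≡ 1
suc-double-%2 zero    = ≡.refl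
suc-double-%2 (suc m) = suc-double-%2 m

double-/2 : ∀ m → double m / 2 ≡ m
double-/2 zero    = ≡.refl
double-/2 (suc m) =
  ≡.trans (m/n≡1+[m∸n]/n {double (suc m)} {2} (s≤s (s≤s z≤n))) (≡.cong suc (double-/2 m))

suc-double-/2 : ∀ m → suc (double m) / 2 ≡ m
suc-double-/2 zero    = ≡.refl
suc-double-/2 (suc m) =
  ≡.trans (m/n≡1+[m∸n]/n {suc (double (suc m))} {2} (s≤s (s≤s z≤n))) (≡.cong suc (suc-double-/2 m))

double-∸-double : ∀ m j → double m ∸ double j ≡ double (m ∸ j)
double-∸-double zero    zero    = ≡.refl
double-∸-double zero    (suc j) = ≡.refl
double-∸-double (suc m) zero    = ≡.refl
double-∸-double (suc m) (suc j) = double-∸-double m j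

suc-double-∸-double : ∀ {m j} → j ≤ m → suc (double m) ∸ double j ≡ suc (double (m ∸ j))
suc-double-∸-double {m} {zero}      _         = ≡.refl
suc-double-∸-double {suc m} {suc j} (s≤s j≤m) = suc-double-∸-double j≤m

double-∸-suc-double : ∀ {m j} → j < m → double m ∸ suc (double j) ≡ suc (double (m ∸ suc j))
double-∸-suc-double {suc m} {zero}  _         = ≡.refl
double-∸-suc-double {suc m} {suc j} (s≤s j<m) = double-∸-suc-double j<m

module SprugnoliGroup {c ℓ} (K : Field c ℓ) where
  open Field K hiding (zero) renaming (_*_ to _·_)
  open Sprugnoli K
  open import Algebra.Properties.CommutativeSemigroup +-commutativeSemigroup
    using (interchange; xy∙z≈xz∙y)

  -- Finite sums
  module _ where
    open SetoidReasoning setoid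

    sumTo-cong : ∀ n {a b : ℕ → Carrier} → (∀ k → k < n → a k ≈ b k) → sumTo n a ≈ sumTo n b
    sumTo-cong zero    a≈b = refl
    sumTo-cong (suc n) a≈b = +-cong (sumTo-cong n (λ k k<n → a≈b k (ℕ.m<n⇒m<1+n k<n))) (a≈b n (ℕ.n<1+n n))

    sumTo-cong′ : ∀ n {a b : ℕ → Carrier} → (∀ k → a k ≈ b k) → sumTo n a ≈ sumTo n b
    sumTo-cong′ n a≈b = sumTo-cong n (λ k _ → a≈b k)

    sumTo-length : ∀ {m m′} (a : ℕ → Carrier) → m ≡ m′ → sumTo m a ≈ sumTo m′ a
    sumTo-length a ≡.refl = refl

    sumTo-zero : ∀ n {a : ℕ → Carrier} → (∀ k → k < n → a k ≈ 0#) → sumTo n a ≈ 0#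
    sumTo-zero zero    a≈0 = refl
    sumTo-zero (suc n) a≈0 =
      trans (+-cong (sumTo-zero n (λ k k<n → a≈0 k (ℕ.m<n⇒m<1+n k<n))) (a≈0 n (ℕ.n<1+n n))) (+-identityˡ 0#)

    sumTo-+ : ∀ n (a b : ℕ → Carrier) → sumTo n (λ k → a k + b k) ≈ sumTo n a + sumTo n b
    sumTo-+ zero    a b = sym (+-identityˡ 0#)
    sumTo-+ (suc n) a b = trans (+-cong (sumTo-+ n a b) refl) (interchange _ _ _ _)

    *-sumTo : ∀ n x (a : ℕ → Carrier) → x · sumTo n a ≈ sumTo n (λ k → x · a k)
    *-sumTo zero    x a = zeroʳ x
    *-sumTo (suc n) x a = trans (distribˡ x _ _) (+-cong (*-sumTo n x a) refl)

    sumTo-* : ∀ n x (a : ℕ → Carrier) → sumTo n a · x ≈ sumTo n (λ k → a k · x)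
    sumTo-* zero    x a = zeroˡ x
    sumTo-* (suc n) x a = trans (distribʳ x _ _) (+-cong (sumTo-* n x a) refl)

    sumTo-head : ∀ n (a : ℕ → Carrier) → sumTo (suc n) a ≈ a 0 + sumTo n (λ k → a (suc k))
    sumTo-head zero    a = trans (+-identityˡ _) (sym (+-identityʳ _))
    sumTo-head (suc n) a = trans (+-cong (sumTo-head n a) refl) (+-assoc _ _ _)

    sumTo-comm : ∀ n m (a : ℕ → ℕ → Carrier) →
      sumTo n (λ i → sumTo m (λ k → a i k)) ≈ sumTo m (λ k → sumTo n (λ i → a i k))
    sumTo-comm zero    m a = sym (sumTo-zero m (λ _ _ → refl))
    sumTo-comm (suc n) m a = trans (+-cong (sumTo-comm n m a) refl) (sym (sumTo-+ m _ _))

    sumTo-vanishing : ∀ {M} N (a : ℕ → Carrier) → M ≤ N → (∀ k → M ≤ k → k < N → a k ≈ 0#) →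
      sumTo N a ≈ sumTo M a
    sumTo-vanishing     zero    a z≤n a≈0 = refl
    sumTo-vanishing {M} (suc N) a M≤1+N a≈0 with ℕ.m≤n⇒m<n∨m≡n M≤1+N
    ... | inj₂ ≡.refl       = refl
    ... | inj₁ (s≤s M≤N) =
      trans (+-cong (sumTo-vanishing N a M≤N (λ k M≤k k<N → a≈0 k M≤k (ℕ.m<n⇒m<1+n k<N)))
                    (a≈0 N M≤N (ℕ.n<1+n N)))
            (+-identityʳ _)

    sumTo-single : ∀ N k (a : ℕ → Carrier) → k < N → (∀ i → i < N → ¬ (i ≡ k) → a i ≈ 0#) →
      sumTo N a ≈ a k
    sumTo-single (suc N) k a k<1+N a≈0 with ℕ.m≤n⇒m<n∨m≡n k<1+N
    ... | inj₂ ≡.refl =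
      trans (+-cong (sumTo-zero N (λ i i<N → a≈0 i (ℕ.m<n⇒m<1+n i<N) (λ i≡N → ℕ.<-irrefl i≡N i<N))) refl)
            (+-identityˡ _)
    ... | inj₁ (s≤s k<N) =
      trans (+-cong (sumTo-single N k a k<N (λ i i<N → a≈0 i (ℕ.m<n⇒m<1+n i<N)))
                    (a≈0 N (ℕ.n<1+n N) (λ N≡k → ℕ.<-irrefl (≡.sym N≡k) k<N)))
            (+-identityʳ _)

    sumTo-double : ∀ N (a : ℕ → Carrier) →
      sumTo (double N) a ≈ sumTo N (λ m → a (double m)) + sumTo N (λ m → a (suc (double m)))
    sumTo-double zero    a = sym (+-identityˡ 0#)
    sumTo-double (suc N) a = trans (+-cong (+-cong (sumTo-double N a) refl) refl)
      (trans (+-assoc _ _ _) (interchange _ _ _ _))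

    sumTo-suc-double : ∀ m (a : ℕ → Carrier) →
      sumTo (suc (double m)) a ≈ sumTo (suc m) (λ j → a (double j)) + sumTo m (λ j → a (suc (double j)))
    sumTo-suc-double m a = trans (+-cong (sumTo-double m a) refl) (xy∙z≈xz∙y _ _ _)

    sumTo-reverse : ∀ n (a : ℕ → Carrier) → sumTo (suc n) a ≈ sumTo (suc n) (λ k → a (n ∸ k))
    sumTo-reverse zero    a = refl
    sumTo-reverse (suc n) a = begin
        sumTo (suc (suc n)) a
      ≈⟨ sumTo-head (suc n) a ⟩
        a 0 + sumTo (suc n) (λ k → a (suc k))
      ≈⟨ +-comm _ _ ⟩
        sumTo (suc n) (λ k → a (suc k)) + a 0
      ≈⟨ +-cong (sumTo-reverse n (λ k → a (suc k))) refl ⟩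
        sumTo (suc n) (λ k → a (suc (n ∸ k))) + a 0
      ≈⟨ +-cong (sumTo-cong (suc n) (λ k k≤n → reflexive (≡.cong a (≡.sym (ℕ.+-∸-assoc 1 (ℕ.≤-pred k≤n))))))
                (reflexive (≡.cong a (≡.sym (ℕ.n∸n≡0 n)))) ⟩
        sumTo (suc n) (λ k → a (suc n ∸ k)) + a (n ∸ n)
      ∎

    sumTo-triangle : ∀ N (G : ℕ → ℕ → Carrier) →
      sumTo N (λ k → sumTo (suc k) (λ i → G i (k ∸ i))) ≈ sumTo N (λ i → sumTo (N ∸ i) (G i))
    sumTo-triangle zero    G = refl
    sumTo-triangle (suc N) G = begin
        sumTo N (λ k → sumTo (suc k) (λ i → G i (k ∸ i))) + (sumTo N (λ i → G i (N ∸ i)) + G N (N ∸ N))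
      ≈⟨ +-cong (sumTo-triangle N G) refl ⟩
        sumTo N (λ i → sumTo (N ∸ i) (G i)) + (sumTo N (λ i → G i (N ∸ i)) + G N (N ∸ N))
      ≈⟨ sym (+-assoc _ _ _) ⟩
        (sumTo N (λ i → sumTo (N ∸ i) (G i)) + sumTo N (λ i → G i (N ∸ i))) + G N (N ∸ N)
      ≈⟨ +-cong (sym (sumTo-+ N _ _)) (trans (reflexive (≡.cong (G N) (ℕ.n∸n≡0 N))) (sym (+-identityˡ _))) ⟩
        sumTo N (λ i → sumTo (N ∸ i) (G i) + G i (N ∸ i)) + sumTo 1 (G N)
      ≈⟨ +-cong (sumTo-cong N (λ i i<N → sumTo-length (G i) (≡.sym (ℕ.+-∸-assoc 1 (ℕ.<⇒≤ i<N)))))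
                (sumTo-length (G N) (≡.sym (ℕ.m+n∸n≡m 1 N))) ⟩
        sumTo N (λ i → sumTo (suc N ∸ i) (G i)) + sumTo (suc N ∸ N) (G N)
      ∎

  -- The semiring of formal power series
  infix  4 _≐_
  infixl 6 _⊕_
  infixl 7 _⋆_

  -- A record wrapper around _≋_: the two series can then be inferred from an equation.
  record _≐_ (f h : PS) : Set ℓ where
    constructor ⟪_⟫
    field _!_ : f ≋ h
  open _≐_ public

  _⊕_ : PS → PS → PS
  (f ⊕ h) n = f n + h n

  _⋆_ : PS → PS → PS
  _⋆_ = mulPS

  zeroPS : PS
  zeroPS _ = 0#

  ≐-refl : ∀ {f} → f ≐ f
  ≐-refl = ⟪ (λ n → refl) ⟫

  ≐-sym : ∀ {f h} → f ≐ h → h ≐ f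
  ≐-sym f≐h = ⟪ (λ n → sym (f≐h ! n)) ⟫

  ≐-trans : ∀ {f h j} → f ≐ h → h ≐ j → f ≐ j
  ≐-trans f≐h h≐j = ⟪ (λ n → trans (f≐h ! n) (h≐j ! n)) ⟫

  ≐-reflexive : ∀ {f h} → f ≡ h → f ≐ h
  ≐-reflexive ≡.refl = ≐-refl

  ≐-setoid : Setoid c ℓ
  ≐-setoid = record
    { Carrier = PS ; _≈_ = _≐_
    ; isEquivalence = record { refl = ≐-refl ; sym = ≐-sym ; trans = ≐-trans } }

  ⊕-cong : ∀ {f f′ h h′} → f ≐ f′ → h ≐ h′ → f ⊕ h ≐ f′ ⊕ h′
  ⊕-cong f≐f′ h≐h′ = ⟪ (λ n → +-cong (f≐f′ ! n) (h≐h′ ! n)) ⟫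

  ⋆-cong : ∀ {f f′ h h′} → f ≐ f′ → h ≐ h′ → f ⋆ h ≐ f′ ⋆ h′
  ⋆-cong f≐f′ h≐h′ =
    ⟪ (λ n → sumTo-cong′ (suc n) (λ k → *-cong (f≐f′ ! k) (h≐h′ ! (n ∸ k)))) ⟫

  ⋆-congˡ : ∀ {f f′} h → f ≐ f′ → f ⋆ h ≐ f′ ⋆ h
  ⋆-congˡ h f≐f′ = ⋆-cong f≐f′ (≐-refl {h})

  ⋆-congʳ : ∀ f {h h′} → h ≐ h′ → f ⋆ h ≐ f ⋆ h′
  ⋆-congʳ f h≐h′ = ⋆-cong (≐-refl {f}) h≐h′

  ⋆-comm : ∀ f h → f ⋆ h ≐ h ⋆ f
  ⋆-comm f h = ⟪ (λ n → trans (sumTo-reverse n _) (sumTo-cong (suc n) (λ k k≤n →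
    trans (*-cong refl (reflexive (≡.cong h (ℕ.m∸[m∸n]≡n (ℕ.≤-pred k≤n))))) (*-comm _ _)))) ⟫

  ⋆-assoc : ∀ a b d → (a ⋆ b) ⋆ d ≐ a ⋆ (b ⋆ d)
  ⋆-assoc a b d = ⟪ coefficient ⟫
    where
    open SetoidReasoning setoid
    G : ℕ → ℕ → ℕ → Carrier
    G n i l = (a i · b l) · d (n ∸ (i +ℕ l))
    coefficient : ∀ n → ((a ⋆ b) ⋆ d) n ≈ (a ⋆ (b ⋆ d)) n
    coefficient n = begin
        sumTo (suc n) (λ k → sumTo (suc k) (λ i → a i · b (k ∸ i)) · d (n ∸ k))
      ≈⟨ sumTo-cong′ (suc n) (λ k → trans (sumTo-* (suc k) _ _) (sumTo-cong (suc k) (λ i i≤k →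
           *-cong refl (reflexive (≡.cong (λ m → d (n ∸ m)) (≡.sym (ℕ.m+[n∸m]≡n (ℕ.≤-pred i≤k)))))))) ⟩
        sumTo (suc n) (λ k → sumTo (suc k) (λ i → G n i (k ∸ i)))
      ≈⟨ sumTo-triangle (suc n) (G n) ⟩
        sumTo (suc n) (λ i → sumTo (suc n ∸ i) (G n i))
      ≈⟨ sumTo-cong (suc n) (λ i i≤n → trans (sumTo-length (G n i) (ℕ.+-∸-assoc 1 (ℕ.≤-pred i≤n)))
           (sumTo-cong′ (suc (n ∸ i)) (λ l → trans (*-assoc _ _ _)
             (*-cong refl (*-cong refl (reflexive (≡.cong d (≡.sym (ℕ.∸-+-assoc n i l))))))))) ⟩
        sumTo (suc n) (λ i → sumTo (suc (n ∸ i)) (λ l → a i · (b l · d (n ∸ i ∸ l))))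
      ≈⟨ sumTo-cong′ (suc n) (λ i → sym (*-sumTo (suc (n ∸ i)) _ _)) ⟩
        sumTo (suc n) (λ i → a i · sumTo (suc (n ∸ i)) (λ l → b l · d (n ∸ i ∸ l)))
      ∎

  ⋆-distribʳ : ∀ d a b → (a ⊕ b) ⋆ d ≐ a ⋆ d ⊕ b ⋆ d
  ⋆-distribʳ d a b = ⟪ (λ n → trans (sumTo-cong′ (suc n) (λ k → distribʳ _ _ _)) (sumTo-+ (suc n) _ _)) ⟫

  ⋆-zeroˡ : ∀ f → zeroPS ⋆ f ≐ zeroPS
  ⋆-zeroˡ f = ⟪ (λ n → sumTo-zero (suc n) (λ k _ → zeroˡ _)) ⟫

  ⋆-identityˡ : ∀ f → onePS ⋆ f ≐ f
  ⋆-identityˡ f = ⟪ (λ n → trans (sumTo-head n _)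
    (trans (+-cong (*-identityˡ _) (sumTo-zero n (λ k _ → zeroˡ _))) (+-identityʳ _))) ⟫

  ⋆-identityʳ : ∀ f → f ⋆ onePS ≐ f
  ⋆-identityʳ f = ≐-trans (⋆-comm f onePS) (⋆-identityˡ f)

  ⋆-distribˡ : ∀ a b d → a ⋆ (b ⊕ d) ≐ a ⋆ b ⊕ a ⋆ d
  ⋆-distribˡ a b d =
    ≐-trans (⋆-comm a (b ⊕ d)) (≐-trans (⋆-distribʳ a b d) (⊕-cong (⋆-comm b a) (⋆-comm d a)))

  PS-commutativeSemiring : CommutativeSemiring c ℓ
  PS-commutativeSemiring = record
    { Carrier = PS ; _≈_ = _≐_ ; _+_ = _⊕_ ; _*_ = _⋆_ ; 0# = zeroPS ; 1# = onePS
    ; isCommutativeSemiring = isCommutativeSemiringˡ (record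
      { +-isCommutativeMonoid = record
        { isMonoid = record
          { isSemigroup = record
            { isMagma = record { isEquivalence = Setoid.isEquivalence ≐-setoid ; ∙-cong = ⊕-cong }
            ; assoc = λ f g h → ⟪ (λ n → +-assoc (f n) (g n) (h n)) ⟫ }
          ; identity = (λ f → ⟪ (λ n → +-identityˡ (f n)) ⟫) , (λ f → ⟪ (λ n → +-identityʳ (f n)) ⟫) }
        ; comm = λ f g → ⟪ (λ n → +-comm (f n) (g n)) ⟫ }
      ; *-isCommutativeMonoid = record
        { isMonoid = record
          { isSemigroup = record
            { isMagma = record { isEquivalence = Setoid.isEquivalence ≐-setoid ; ∙-cong = ⋆-cong }
            ; assoc = ⋆-assoc }
          ; identity = ⋆-identityˡ , ⋆-identityʳ }
        ; comm = ⋆-comm }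
      ; distribʳ = ⋆-distribʳ
      ; zeroˡ = ⋆-zeroˡ }) }

  module PS-Solver = Solver PS-commutativeSemiring

  open import Algebra.Properties.CommutativeSemigroup
    (CommutativeSemiring.*-commutativeSemigroup PS-commutativeSemiring)
    using () renaming (x∙yz≈y∙xz to ⋆-leftComm)

  module _ where
    open SetoidReasoning setoid

    X⋆-zero : ∀ f → (X ⋆ f) 0 ≈ 0#
    X⋆-zero f = trans (+-identityˡ _) (zeroˡ _)

    X⋆-suc : ∀ f n → (X ⋆ f) (suc n) ≈ f n
    X⋆-suc f n = begin
        (X ⋆ f) (suc n)
      ≈⟨ sumTo-head (suc n) _ ⟩
        0# · f (suc n) + sumTo (suc n) (λ k → X (suc k) · f (n ∸ k))
      ≈⟨ +-cong (zeroˡ _) (sumTo-head n _) ⟩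
        0# + (1# · f n + sumTo n (λ k → 0# · f (n ∸ suc k)))
      ≈⟨ +-identityˡ _ ⟩
        1# · f n + sumTo n (λ k → 0# · f (n ∸ suc k))
      ≈⟨ +-cong (*-identityˡ _) (sumTo-zero n (λ k _ → zeroˡ _)) ⟩
        f n + 0#
      ≈⟨ +-identityʳ _ ⟩
        f n
      ∎

  X⋆shiftPS : ∀ D → D 0 ≈ 0# → X ⋆ shiftPS D ≐ D
  X⋆shiftPS D D₀≈0 = ⟪ (λ { zero    → trans (X⋆-zero (shiftPS D)) (sym D₀≈0)
                           ; (suc n) → X⋆-suc (shiftPS D) n }) ⟫

  X⋆-cancel : ∀ {a b} → X ⋆ a ≐ X ⋆ b → a ≐ b
  X⋆-cancel {a} {b} Xa≐Xb = ⟪ (λ n → trans (sym (X⋆-suc a n)) (trans (Xa≐Xb ! suc n) (X⋆-suc b n))) ⟫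

  powPS-cong : ∀ {f f′} k → f ≐ f′ → powPS f k ≐ powPS f′ k
  powPS-cong zero    f≐f′ = ≐-refl
  powPS-cong (suc k) f≐f′ = ⋆-cong f≐f′ (powPS-cong k f≐f′)

  powPS-+ : ∀ f i j → powPS f (i +ℕ j) ≐ powPS f i ⋆ powPS f j
  powPS-+ f zero    j = ≐-sym (⋆-identityˡ _)
  powPS-+ f (suc i) j = ≐-trans (⋆-congʳ f (powPS-+ f i j)) (≐-sym (⋆-assoc f (powPS f i) (powPS f j)))

  powPS-double : ∀ f m → powPS (f ⋆ f) m ≐ powPS f (double m)
  powPS-double f zero    = ≐-refl
  powPS-double f (suc m) = ≐-trans (⋆-congʳ (f ⋆ f) (powPS-double f m)) (⋆-assoc f f (powPS f (double m)))

  powX-diagonal : ∀ n → powPS X n n ≈ 1#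
  powX-diagonal zero    = refl
  powX-diagonal (suc n) = trans (X⋆-suc (powPS X n) n) (powX-diagonal n)

  powX-offDiagonal : ∀ k n → ¬ (n ≡ k) → powPS X k n ≈ 0#
  powX-offDiagonal zero    zero    n≢k = ⊥-elim (n≢k ≡.refl)
  powX-offDiagonal zero    (suc n) n≢k = refl
  powX-offDiagonal (suc k) zero    n≢k = X⋆-zero (powPS X k)
  powX-offDiagonal (suc k) (suc n) n≢k =
    trans (X⋆-suc (powPS X k) n) (powX-offDiagonal k n (λ n≡k → n≢k (≡.cong suc n≡k)))

  module _ where
    open SetoidReasoning setoid

    nonzero·≈0⇒≈0 : ∀ {a b} → ¬ (a ≈ 0#) → a · b ≈ 0# → b ≈ 0#
    nonzero·≈0⇒≈0 {a} {b} a≉0 ab≈0 = begin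
        b                  ≈⟨ sym (*-identityˡ b) ⟩
        1# · b             ≈⟨ *-cong (sym (trans (*-comm _ _) (⁻¹-inverse a a≉0))) refl ⟩
        (a ⁻¹ · a) · b     ≈⟨ *-assoc _ _ _ ⟩
        a ⁻¹ · (a · b)     ≈⟨ *-cong refl ab≈0 ⟩
        a ⁻¹ · 0#          ≈⟨ zeroʳ _ ⟩
        0#                 ∎

    ·-nonzero : ∀ {a b} → ¬ (a ≈ 0#) → ¬ (b ≈ 0#) → ¬ (a · b ≈ 0#)
    ·-nonzero a≉0 b≉0 ab≈0 = b≉0 (nonzero·≈0⇒≈0 a≉0 ab≈0)

    ⁻¹-nonzero : ∀ {a} → ¬ (a ≈ 0#) → ¬ (a ⁻¹ ≈ 0#)
    ⁻¹-nonzero {a} a≉0 a⁻¹≈0 =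
      0≉1 (trans (sym (trans (*-cong refl a⁻¹≈0) (zeroʳ a))) (⁻¹-inverse a a≉0))

    cancel-⁻¹ : ∀ {a} → ¬ (a ≈ 0#) → ∀ b → a · (a ⁻¹ · b) ≈ b
    cancel-⁻¹ {a} a≉0 b = trans (sym (*-assoc _ _ _)) (trans (*-cong (⁻¹-inverse a a≉0) refl) (*-identityˡ b))

    1≉0 : ¬ (1# ≈ 0#)
    1≉0 1≈0 = 0≉1 (sym 1≈0)

  module _ where
    open import Algebra.Properties.Ring ring using (-‿distribʳ-*)
    open SetoidReasoning setoid

    at-++ : ∀ (xs ys : List Carrier) m → m < length xs → at (xs ++ ys) m ≡ at xs m
    at-++ (x ∷ xs) ys zero    _         = ≡.refl
    at-++ (x ∷ xs) ys (suc m) (s≤s m<n) = at-++ xs ys m m<n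

    at-length : ∀ (xs : List Carrier) y → at (xs ++ (y ∷ [])) (length xs) ≡ y
    at-length []       y = ≡.refl
    at-length (x ∷ xs) y = at-length xs y

    invCoeffs-length : ∀ f n → length (invCoeffs f n) ≡ suc n
    invCoeffs-length f zero    = ≡.refl
    invCoeffs-length f (suc n) = ≡.trans (List.length-++ (invCoeffs f n))
      (≡.trans (≡.cong (_+ℕ 1) (invCoeffs-length f n)) (ℕ.+-comm (suc n) 1))

    at-invCoeffs : ∀ f n m → m ≤ n → at (invCoeffs f n) m ≡ invPS f m
    at-invCoeffs f zero    zero _   = ≡.refl
    at-invCoeffs f (suc n) m m≤1+n with ℕ.m≤n⇒m<n∨m≡n m≤1+n
    ... | inj₂ ≡.refl    = ≡.refl
    ... | inj₁ (s≤s m≤n) = ≡.trans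
      (at-++ (invCoeffs f n) _ m (≡.subst (m <_) (≡.sym (invCoeffs-length f n)) (s≤s m≤n)))
      (at-invCoeffs f n m m≤n)

    invPS-suc : ∀ f n → invPS f (suc n) ≈ - (f 0 ⁻¹ · sumTo (suc n) (λ k → f (suc k) · invPS f (n ∸ k)))
    invPS-suc f n = begin
        invPS f (suc n)
      ≡⟨ ≡.trans (≡.cong (at (invCoeffs f n ++ _)) (≡.sym (invCoeffs-length f n)))
                 (at-length (invCoeffs f n) _) ⟩
        - (f 0 ⁻¹ · sumTo (suc n) (λ k → f (suc k) · at (invCoeffs f n) (n ∸ k)))
      ≈⟨ -‿cong (*-cong refl (sumTo-cong′ (suc n) (λ k →
           *-cong refl (reflexive (at-invCoeffs f n (n ∸ k) (ℕ.m∸n≤m n k)))))) ⟩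
        - (f 0 ⁻¹ · sumTo (suc n) (λ k → f (suc k) · invPS f (n ∸ k)))
      ∎

    invPS-inverseʳ : ∀ f → ¬ (f 0 ≈ 0#) → f ⋆ invPS f ≐ onePS
    invPS-inverseʳ f f₀≉0 = ⟪ coefficient ⟫
      where
      coefficient : ∀ n → (f ⋆ invPS f) n ≈ onePS n
      coefficient zero    = trans (+-identityˡ _) (⁻¹-inverse _ f₀≉0)
      coefficient (suc n) = begin
          (f ⋆ invPS f) (suc n)
        ≈⟨ sumTo-head (suc n) _ ⟩
          f 0 · invPS f (suc n) + s
        ≈⟨ +-cong (*-cong refl (invPS-suc f n)) refl ⟩
          f 0 · - (f 0 ⁻¹ · s) + s
        ≈⟨ +-cong (sym (-‿distribʳ-* _ _)) refl ⟩
          - (f 0 · (f 0 ⁻¹ · s)) + s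
        ≈⟨ +-cong (-‿cong (cancel-⁻¹ f₀≉0 s)) refl ⟩
          - s + s
        ≈⟨ -‿inverseˡ s ⟩
          0#
        ∎
        where
        s : Carrier
        s = sumTo (suc n) (λ k → f (suc k) · invPS f (n ∸ k))

  module _ where
    open SetoidReasoning ≐-setoid

    ⋆-cancelˡ : ∀ {g a b} → ¬ (g 0 ≈ 0#) → g ⋆ a ≐ g ⋆ b → a ≐ b
    ⋆-cancelˡ {g} {a} {b} g₀≉0 ga≐gb = begin
        a                      ≈⟨ ≐-sym (⋆-identityˡ a) ⟩
        onePS ⋆ a              ≈⟨ ⋆-congˡ a (≐-sym (invPS-inverseʳ g g₀≉0)) ⟩
        (g ⋆ invPS g) ⋆ a      ≈⟨ ⋆-congˡ a (⋆-comm g (invPS g)) ⟩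
        (invPS g ⋆ g) ⋆ a      ≈⟨ ⋆-assoc (invPS g) g a ⟩
        invPS g ⋆ (g ⋆ a)      ≈⟨ ⋆-congʳ (invPS g) ga≐gb ⟩
        invPS g ⋆ (g ⋆ b)      ≈⟨ ≐-sym (⋆-assoc (invPS g) g b) ⟩
        (invPS g ⋆ g) ⋆ b      ≈⟨ ⋆-congˡ b (⋆-comm (invPS g) g) ⟩
        (g ⋆ invPS g) ⋆ b      ≈⟨ ⋆-congˡ b (invPS-inverseʳ g g₀≉0) ⟩
        onePS ⋆ b              ≈⟨ ⋆-identityˡ b ⟩
        b                      ∎

    ⋆-divPS : ∀ {h} A → ¬ (h 0 ≈ 0#) → h ⋆ divPS A h ≐ A
    ⋆-divPS {h} A h₀≉0 = begin
        h ⋆ (A ⋆ invPS h)      ≈⟨ ⋆-congʳ h (⋆-comm A (invPS h)) ⟩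
        h ⋆ (invPS h ⋆ A)      ≈⟨ ≐-sym (⋆-assoc h (invPS h) A) ⟩
        (h ⋆ invPS h) ⋆ A      ≈⟨ ⋆-congˡ A (invPS-inverseʳ h h₀≉0) ⟩
        onePS ⋆ A              ≈⟨ ⋆-identityˡ A ⟩
        A                      ∎

  -- Orders of power series
  OrderAtLeast : ℕ → PS → Set ℓ
  OrderAtLeast p a = ∀ j → j < p → a j ≈ 0#

  OrderAtLeast-suc : ∀ {p h} → OrderAtLeast p h → h p ≈ 0# → OrderAtLeast (suc p) h
  OrderAtLeast-suc ord-h hₚ≈0 j j≤p with ℕ.m≤n⇒m<n∨m≡n (ℕ.≤-pred j≤p)
  ... | inj₁ j<p    = ord-h j j<p
  ... | inj₂ ≡.refl = hₚ≈0

  OrderAtLeast-⋆ : ∀ {p q a b} → OrderAtLeast p a → OrderAtLeast q b → OrderAtLeast (p +ℕ q) (a ⋆ b)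
  OrderAtLeast-⋆ {p} {q} {a} {b} ord-a ord-b j j<p+q = sumTo-zero (suc j) term
    where
    term : ∀ i → i < suc j → a i · b (j ∸ i) ≈ 0#
    term i i≤j with i ℕ.<? p
    ... | yes i<p = trans (*-cong (ord-a i i<p) refl) (zeroˡ _)
    ... | no  i≮p = trans (*-cong refl (ord-b (j ∸ i) j∸i<q)) (zeroʳ _)
      where
      j∸i<q : j ∸ i < q
      j∸i<q = ℕ.+-cancelˡ-< i (j ∸ i) q (≡.subst (_< i +ℕ q) (≡.sym (ℕ.m+[n∸m]≡n (ℕ.≤-pred i≤j)))
                (ℕ.<-≤-trans j<p+q (ℕ.+-monoˡ-≤ q (ℕ.≮⇒≥ i≮p))))

  OrderAtLeast-pow : ∀ {p f} k → OrderAtLeast p f → OrderAtLeast (k *ℕ p) (powPS f k)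
  OrderAtLeast-pow zero    ord-f = λ j ()
  OrderAtLeast-pow (suc k) ord-f = OrderAtLeast-⋆ ord-f (OrderAtLeast-pow k ord-f)

  OrderAtLeast-pow₁ : ∀ {f} → f 0 ≈ 0# → ∀ k → OrderAtLeast k (powPS f k)
  OrderAtLeast-pow₁ {f} f₀≈0 k =
    ≡.subst (λ p → OrderAtLeast p (powPS f k)) (ℕ.*-identityʳ k)
            (OrderAtLeast-pow k (λ { zero _ → f₀≈0 ; (suc j) (s≤s ()) }))

  ⋆-leading : ∀ {p q a b} → OrderAtLeast p a → OrderAtLeast q b → (a ⋆ b) (p +ℕ q) ≈ a p · b q
  ⋆-leading {p} {q} {a} {b} ord-a ord-b =
    trans (sumTo-single (suc (p +ℕ q)) p _ (s≤s (ℕ.m≤m+n p q)) term)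
          (*-cong refl (reflexive (≡.cong b (ℕ.m+n∸m≡n p q))))
    where
    term : ∀ i → i < suc (p +ℕ q) → ¬ (i ≡ p) → a i · b (p +ℕ q ∸ i) ≈ 0#
    term i i≤p+q i≢p with ℕ.<-cmp i p
    ... | tri< i<p _ _ = trans (*-cong (ord-a i i<p) refl) (zeroˡ _)
    ... | tri≈ _ i≡p _ = ⊥-elim (i≢p i≡p)
    ... | tri> _ _ p<i = trans (*-cong refl (ord-b _ p+q∸i<q)) (zeroʳ _)
      where
      p+q∸i<q : p +ℕ q ∸ i < q
      p+q∸i<q = ≡.subst (p +ℕ q ∸ i <_) (ℕ.m+n∸m≡n p q) (ℕ.∸-monoʳ-< p<i (ℕ.≤-pred i≤p+q))

  InF-cong : ∀ {p a b} → a ≐ b → InF p a → InF p b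
  InF-cong {p} a≐b (ord-a , a≉0) =
    (λ j j<p → trans (sym (a≐b ! j)) (ord-a j j<p)) , λ b≈0 → a≉0 (trans (a≐b ! p) b≈0)

  InF-⋆ : ∀ {p q a b} → InF p a → InF q b → InF (p +ℕ q) (a ⋆ b)
  InF-⋆ (ord-a , a≉0) (ord-b , b≉0) =
    OrderAtLeast-⋆ ord-a ord-b , λ ab≈0 → ·-nonzero a≉0 b≉0 (trans (sym (⋆-leading ord-a ord-b)) ab≈0)

  InF-onePS : InF 0 onePS
  InF-onePS = (λ j ()) , 1≉0

  InF-X : InF 1 X
  InF-X = (λ { zero _ → refl ; (suc j) (s≤s ()) }) , 1≉0

  InF-pow : ∀ {p f} k → InF p f → InF (k *ℕ p) (powPS f k)
  InF-pow zero    _     = InF-onePS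
  InF-pow (suc k) f-InF = InF-⋆ f-InF (InF-pow k f-InF)

  InF-invPS : ∀ {f} → ¬ (f 0 ≈ 0#) → InF 0 (invPS f)
  InF-invPS f₀≉0 = (λ j ()) , ⁻¹-nonzero f₀≉0

  InF-shiftPS : ∀ {p D} → InF (suc p) D → InF p (shiftPS D)
  InF-shiftPS (ord-D , D≉0) = (λ j j<p → ord-D (suc j) (s≤s j<p)) , D≉0

  -- Lower-triangular matrices and composition
  LowerTriangular : (ℕ → PS) → Set ℓ
  LowerTriangular c = ∀ k → OrderAtLeast k (c k)

  -- The matrix with columns c applied to h, with the sum cut off at k ≤ n: this is the matrix product
  -- only for lower-triangular c. By definition act S is apply (column S).
  apply : (ℕ → PS) → PS → PS
  apply c h n = sumTo (suc n) (λ k → c k n · h k)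

  module _ where
    open SetoidReasoning setoid

    apply-extend : ∀ {c} h → LowerTriangular c → ∀ N n → n < N → apply c h n ≈ sumTo N (λ k → c k n · h k)
    apply-extend {c} h c-lower N n n<N =
      sym (sumTo-vanishing N _ n<N (λ k n<k _ → trans (*-cong (c-lower k n n<k) refl) (zeroˡ _)))

    apply-cong : ∀ {c c′ h h′} → (∀ k → c k ≐ c′ k) → h ≐ h′ → apply c h ≐ apply c′ h′
    apply-cong c≐c′ h≐h′ =
      ⟪ (λ n → sumTo-cong′ (suc n) (λ k → *-cong (c≐c′ k ! n) (h≐h′ ! k))) ⟫

    LowerTriangular-⋆ : ∀ {c} a → LowerTriangular c → LowerTriangular (λ k → a ⋆ c k)
    LowerTriangular-⋆ {c} a c-lower k = OrderAtLeast-⋆ {0} {k} {a} {c k} (λ j ()) (c-lower k)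

    ⋆-apply : ∀ {c} → LowerTriangular c → ∀ a h → a ⋆ apply c h ≐ apply (λ k → a ⋆ c k) h
    ⋆-apply {c} c-lower a h = ⟪ coefficient ⟫
      where
      coefficient : ∀ n → (a ⋆ apply c h) n ≈ apply (λ k → a ⋆ c k) h n
      coefficient n = begin
          sumTo (suc n) (λ i → a i · apply c h (n ∸ i))
        ≈⟨ sumTo-cong′ (suc n) (λ i →
             *-cong refl (apply-extend h c-lower (suc n) (n ∸ i) (s≤s (ℕ.m∸n≤m n i)))) ⟩
          sumTo (suc n) (λ i → a i · sumTo (suc n) (λ k → c k (n ∸ i) · h k))
        ≈⟨ sumTo-cong′ (suc n) (λ i → *-sumTo (suc n) (a i) _) ⟩
          sumTo (suc n) (λ i → sumTo (suc n) (λ k → a i · (c k (n ∸ i) · h k)))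
        ≈⟨ sumTo-comm (suc n) (suc n) _ ⟩
          sumTo (suc n) (λ k → sumTo (suc n) (λ i → a i · (c k (n ∸ i) · h k)))
        ≈⟨ sumTo-cong′ (suc n) (λ k → trans (sumTo-cong′ (suc n) (λ i → sym (*-assoc _ _ _)))
                                            (sym (sumTo-* (suc n) (h k) _))) ⟩
          sumTo (suc n) (λ k → (a ⋆ c k) n · h k)
        ∎

    apply-apply : ∀ {d} c → LowerTriangular d → ∀ h → apply c (apply d h) ≐ apply (λ k → apply c (d k)) h
    apply-apply {d} c d-lower h = ⟪ coefficient ⟫
      where
      coefficient : ∀ n → apply c (apply d h) n ≈ apply (λ k → apply c (d k)) h n
      coefficient n = begin
          sumTo (suc n) (λ j → c j n · apply d h j)
        ≈⟨ sumTo-cong (suc n) (λ j j≤n →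
             trans (*-cong refl (apply-extend h d-lower (suc n) j j≤n)) (*-sumTo (suc n) _ _)) ⟩
          sumTo (suc n) (λ j → sumTo (suc n) (λ k → c j n · (d k j · h k)))
        ≈⟨ sumTo-comm (suc n) (suc n) _ ⟩
          sumTo (suc n) (λ k → sumTo (suc n) (λ j → c j n · (d k j · h k)))
        ≈⟨ sumTo-cong′ (suc n) (λ k →
             trans (sumTo-cong′ (suc n) (λ j → sym (*-assoc _ _ _))) (sym (sumTo-* (suc n) _ _))) ⟩
          sumTo (suc n) (λ k → apply c (d k) n · h k)
        ∎

    apply-⋆ : ∀ {c} → LowerTriangular c → (∀ i j → c (i +ℕ j) ≐ c i ⋆ c j) →
      ∀ a b → apply c a ⋆ apply c b ≐ apply c (a ⋆ b)
    apply-⋆ {c} c-lower c-hom a b = ≐-trans (⋆-apply c-lower (apply c a) b) ⟪ coefficient ⟫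
      where
      G : ℕ → ℕ → ℕ → Carrier
      G n i l = c (i +ℕ l) n · (a i · b l)
      column-l : ∀ l → apply c a ⋆ c l ≐ apply (λ i → c (l +ℕ i)) a
      column-l l = ≐-trans (⋆-comm (apply c a) (c l))
        (≐-trans (⋆-apply c-lower (c l) a) (apply-cong (λ i → ≐-sym (c-hom l i)) ≐-refl))
      coefficient : ∀ n → apply (λ l → apply c a ⋆ c l) b n ≈ apply c (a ⋆ b) n
      coefficient n = begin
          sumTo (suc n) (λ l → (apply c a ⋆ c l) n · b l)
        ≈⟨ sumTo-cong′ (suc n) (λ l → trans (*-cong (column-l l ! n) refl) (trans (sumTo-* (suc n) (b l) _)
             (sumTo-cong′ (suc n) (λ i → trans (*-assoc _ _ _)
               (*-cong (reflexive (≡.cong (λ m → c m n) (ℕ.+-comm l i))) refl))))) ⟩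
          sumTo (suc n) (λ l → sumTo (suc n) (λ i → G n i l))
        ≈⟨ sym (sumTo-comm (suc n) (suc n) _) ⟩
          sumTo (suc n) (λ i → sumTo (suc n) (λ l → G n i l))
        ≈⟨ sumTo-cong′ (suc n) (λ i → sumTo-vanishing (suc n) (G n i) (ℕ.m∸n≤m (suc n) i)
             (λ l 1+n∸i≤l _ → trans (*-cong (c-lower (i +ℕ l) n (n<i+l i l 1+n∸i≤l)) refl) (zeroˡ _))) ⟩
          sumTo (suc n) (λ i → sumTo (suc n ∸ i) (G n i))
        ≈⟨ sym (sumTo-triangle (suc n) (G n)) ⟩
          sumTo (suc n) (λ k → sumTo (suc k) (λ i → G n i (k ∸ i)))
        ≈⟨ sumTo-cong′ (suc n) (λ k → trans
             (sumTo-cong (suc k) (λ i i≤k → *-cong (reflexive (≡.cong (λ m → c m n) (ℕ.m+[n∸m]≡n (ℕ.≤-pred i≤k)))) refl))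
             (sym (*-sumTo (suc k) _ _))) ⟩
          sumTo (suc n) (λ k → c k n · (a ⋆ b) k)
        ∎
        where
        n<i+l : ∀ i l → suc n ∸ i ≤ l → n < i +ℕ l
        n<i+l i l 1+n∸i≤l = ℕ.≤-trans (ℕ.m≤n+m∸n (suc n) i) (ℕ.+-monoʳ-≤ i 1+n∸i≤l)

    apply-onePS : ∀ {c} → c 0 ≐ onePS → apply c onePS ≐ onePS
    apply-onePS {c} c₀≐1 =
      ⟪ (λ n → trans (sumTo-single (suc n) 0 _ (s≤s z≤n) off-zero) (trans (*-identityʳ _) (c₀≐1 ! n))) ⟫
      where
      off-zero : ∀ {n} i → i < suc n → ¬ (i ≡ 0) → c i n · onePS i ≈ 0#
      off-zero zero    _ i≢0 = ⊥-elim (i≢0 ≡.refl)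
      off-zero (suc i) _ _   = zeroʳ _

    apply-powX : ∀ h → apply (powPS X) h ≐ h
    apply-powX h = ⟪ (λ n → trans (sumTo-single (suc n) n _ (ℕ.n<1+n n) (λ k _ k≢n →
        trans (*-cong (powX-offDiagonal k n (λ n≡k → k≢n (≡.sym n≡k))) refl) (zeroˡ _)))
      (trans (*-cong (powX-diagonal n) refl) (*-identityˡ _))) ⟫

    apply-to-powX : ∀ {c} → LowerTriangular c → ∀ k → apply c (powPS X k) ≐ c k
    apply-to-powX {c} c-lower k = ⟪ coefficient ⟫
      where
      coefficient : ∀ n → apply c (powPS X k) n ≈ c k n
      coefficient n with k ℕ.≤? n
      ... | yes k≤n =
        trans (sumTo-single (suc n) k _ (s≤s k≤n) (λ j _ j≢k → trans (*-cong refl (powX-offDiagonal k j j≢k)) (zeroʳ _)))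
              (trans (*-cong refl (powX-diagonal k)) (*-identityʳ _))
      ... | no  k≰n =
        trans (sumTo-zero (suc n) (λ j j≤n →
                 trans (*-cong refl (powX-offDiagonal k j (λ { ≡.refl → k≰n (ℕ.≤-pred j≤n) }))) (zeroʳ _)))
              (sym (c-lower k n (ℕ.≰⇒> k≰n)))

  module _ {c : ℕ → PS} where
    apply-leading : ∀ {p h} → OrderAtLeast p h → apply c h p ≈ c p p · h p
    apply-leading {p} {h} ord-h =
      trans (+-cong (sumTo-zero p (λ k k<p → trans (*-cong refl (ord-h k k<p)) (zeroʳ _))) refl) (+-identityˡ _)

    OrderAtLeast-apply : ∀ {p h} → OrderAtLeast p h → OrderAtLeast p (apply c h)
    OrderAtLeast-apply ord-h j j<p =
      sumTo-zero (suc j) (λ k k≤j → trans (*-cong refl (ord-h k (ℕ.<-≤-trans k≤j j<p))) (zeroʳ _))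

    OrderAtLeast-apply⁻¹ : (∀ k → ¬ (c k k ≈ 0#)) →
      ∀ {p h} → OrderAtLeast p (apply c h) → OrderAtLeast p h
    OrderAtLeast-apply⁻¹ diagonal {zero}  ord-ch = λ j ()
    OrderAtLeast-apply⁻¹ diagonal {suc p} {h} ord-ch = OrderAtLeast-suc ord-h
      (nonzero·≈0⇒≈0 (diagonal p) (trans (sym (apply-leading ord-h)) (ord-ch p (ℕ.n<1+n p))))
      where
      ord-h : OrderAtLeast p h
      ord-h = OrderAtLeast-apply⁻¹ diagonal (λ i i<p → ord-ch i (ℕ.m<n⇒m<1+n i<p))

    InF-apply : (∀ k → ¬ (c k k ≈ 0#)) → ∀ {p h} → InF p h → InF p (apply c h)
    InF-apply diagonal (ord-h , h≉0) =
      OrderAtLeast-apply ord-h , λ ch≈0 → ·-nonzero (diagonal _) h≉0 (trans (sym (apply-leading ord-h)) ch≈0)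

    InF-apply⁻¹ : (∀ k → ¬ (c k k ≈ 0#)) → ∀ {p h} → InF p (apply c h) → InF p h
    InF-apply⁻¹ diagonal {p} {h} (ord-ch , ch≉0) =
      ord-h , λ h≈0 → ch≉0 (trans (apply-leading ord-h) (trans (*-cong refl h≈0) (zeroʳ _)))
      where
      ord-h : OrderAtLeast p h
      ord-h = OrderAtLeast-apply⁻¹ diagonal ord-ch

  module TriangularSolution (c : ℕ → PS) (t : PS) where
    nextCoefficient : (ℕ → Carrier) → ℕ → Carrier
    nextCoefficient s n = c n n ⁻¹ · (t n - sumTo n (λ k → c k n · s k))

    -- solutionUpTo n k is the k-th coefficient of the solution when k < n.
    solutionUpTo : ℕ → ℕ → Carrier
    solutionUpTo zero    k = 0#
    solutionUpTo (suc n) k with k ≟ n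
    ... | yes _ = nextCoefficient (solutionUpTo n) n
    ... | no  _ = solutionUpTo n k

    solution : PS
    solution k = solutionUpTo (suc k) k

    solutionUpTo-last : ∀ n → solutionUpTo (suc n) n ≡ nextCoefficient (solutionUpTo n) n
    solutionUpTo-last n with n ≟ n
    ... | yes _   = ≡.refl
    ... | no  n≢n = ⊥-elim (n≢n ≡.refl)

    solutionUpTo-earlier : ∀ {n k} → k < n → solutionUpTo (suc n) k ≡ solutionUpTo n k
    solutionUpTo-earlier {n} {k} k<n with k ≟ n
    ... | yes ≡.refl = ⊥-elim (ℕ.<-irrefl ≡.refl k<n)
    ... | no  _      = ≡.refl

    solutionUpTo-stable : ∀ n k → k < n → solutionUpTo n k ≡ solution k
    solutionUpTo-stable (suc n) k k≤n with ℕ.m≤n⇒m<n∨m≡n (ℕ.≤-pred k≤n)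
    ... | inj₁ k<n    = ≡.trans (solutionUpTo-earlier k<n) (solutionUpTo-stable n k k<n)
    ... | inj₂ ≡.refl = ≡.refl

    solution-solves : (∀ k → ¬ (c k k ≈ 0#)) → apply c solution ≐ t
    solution-solves diagonal = ⟪ coefficient ⟫
      where
      open SetoidReasoning setoid
      coefficient : ∀ n → apply c solution n ≈ t n
      coefficient n = begin
          sumTo n (λ k → c k n · solution k) + c n n · solution n
        ≈⟨ +-cong (sumTo-cong n (λ k k<n → *-cong refl (reflexive (≡.sym (solutionUpTo-stable n k k<n)))))
                  (*-cong refl (reflexive (solutionUpTo-last n))) ⟩
          s + c n n · (c n n ⁻¹ · (t n - s))
        ≈⟨ +-cong refl (cancel-⁻¹ (diagonal n) (t n - s)) ⟩
          s + (t n - s)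
        ≈⟨ +-cong refl (+-comm _ _) ⟩
          s + (- s + t n)
        ≈⟨ sym (+-assoc _ _ _) ⟩
          (s + - s) + t n
        ≈⟨ +-cong (-‿inverseʳ s) refl ⟩
          0# + t n
        ≈⟨ +-identityˡ _ ⟩
          t n
        ∎
        where
        s : Carrier
        s = sumTo n (λ k → c k n · solutionUpTo n k)

  apply-surjective : ∀ {c} → (∀ k → ¬ (c k k ≈ 0#)) → ∀ t → Σ PS (λ h → apply c h ≐ t)
  apply-surjective {c} diagonal t = solution , solution-solves diagonal
    where open TriangularSolution c t

  infixr 9 _∘ₚ_
  _∘ₚ_ : PS → PS → PS
  Q ∘ₚ F = apply (powPS F) Q

  ∘ₚ-cong : ∀ {Q Q′ F F′} → Q ≐ Q′ → F ≐ F′ → Q ∘ₚ F ≐ Q′ ∘ₚ F′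
  ∘ₚ-cong Q≐Q′ F≐F′ = apply-cong (λ k → powPS-cong k F≐F′) Q≐Q′

  ∘ₚ-constant : ∀ Q F → (Q ∘ₚ F) 0 ≈ Q 0
  ∘ₚ-constant Q F = trans (+-identityˡ _) (*-identityˡ _)

  module _ {F : PS} (F₀≈0 : F 0 ≈ 0#) where
    ∘ₚ-⋆ : ∀ a b → (a ∘ₚ F) ⋆ (b ∘ₚ F) ≐ (a ⋆ b) ∘ₚ F
    ∘ₚ-⋆ = apply-⋆ (OrderAtLeast-pow₁ F₀≈0) (powPS-+ F)

    ∘ₚ-pow : ∀ a k → powPS (a ∘ₚ F) k ≐ powPS a k ∘ₚ F
    ∘ₚ-pow a zero    = ≐-sym (apply-onePS ≐-refl)
    ∘ₚ-pow a (suc k) = ≐-trans (⋆-congʳ (a ∘ₚ F) (∘ₚ-pow a k)) (∘ₚ-⋆ a (powPS a k))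

  -- stretch Q is Q(x²).
  stretch : PS → PS
  stretch Q zero          = Q 0
  stretch Q (suc zero)    = 0#
  stretch Q (suc (suc n)) = stretch (λ m → Q (suc m)) n

  evenPart oddPart : PS → PS
  evenPart h m = h (double m)
  oddPart  h m = h (suc (double m))

  Even : PS → Set ℓ
  Even P = ∀ m → P (suc (double m)) ≈ 0#

  Even-cong : ∀ {a b} → a ≐ b → Even a → Even b
  Even-cong a≐b a-even m = trans (sym (a≐b ! _)) (a-even m)

  stretch-double : ∀ Q m → stretch Q (double m) ≡ Q m
  stretch-double Q zero    = ≡.refl
  stretch-double Q (suc m) = stretch-double (λ j → Q (suc j)) m

  stretch-suc-double : ∀ Q m → stretch Q (suc (double m)) ≡ 0#
  stretch-suc-double Q zero    = ≡.refl
  stretch-suc-double Q (suc m) = stretch-suc-double (λ j → Q (suc j)) m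

  Even-stretch : ∀ Q → Even (stretch Q)
  Even-stretch Q m = reflexive (stretch-suc-double Q m)

  evenPart-stretch : ∀ Q → evenPart (stretch Q) ≐ Q
  evenPart-stretch Q = ⟪ (λ m → reflexive (stretch-double Q m)) ⟫

  Even⇒stretch-evenPart : ∀ {P} → Even P → P ≐ stretch (evenPart P)
  Even⇒stretch-evenPart {P} P-even = ⟪ coefficient ⟫
    where
    coefficient : ∀ n → P n ≈ stretch (evenPart P) n
    coefficient n with parity n
    ... | even m = reflexive (≡.sym (stretch-double (evenPart P) m))
    ... | odd  m = trans (P-even m) (reflexive (≡.sym (stretch-suc-double (evenPart P) m)))

  stretch-cong : ∀ {a b} → a ≐ b → stretch a ≐ stretch b
  stretch-cong {a} {b} a≐b = ⟪ coefficient ⟫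
    where
    coefficient : ∀ n → stretch a n ≈ stretch b n
    coefficient n with parity n
    ... | even m =
      trans (reflexive (stretch-double a m)) (trans (a≐b ! m) (reflexive (≡.sym (stretch-double b m))))
    ... | odd  m = trans (reflexive (stretch-suc-double a m)) (reflexive (≡.sym (stretch-suc-double b m)))

  module _ where
    open SetoidReasoning setoid

    evenPart-⋆-stretch : ∀ h Q → evenPart (h ⋆ stretch Q) ≐ evenPart h ⋆ Q
    evenPart-⋆-stretch h Q = ⟪ coefficient ⟫
      where
      coefficient : ∀ m → (h ⋆ stretch Q) (double m) ≈ (evenPart h ⋆ Q) m
      coefficient m = begin
          sumTo (suc (double m)) (λ k → h k · stretch Q (double m ∸ k))
        ≈⟨ sumTo-suc-double m _ ⟩
          sumTo (suc m) (λ j → h (double j) · stretch Q (double m ∸ double j))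
            + sumTo m (λ j → h (suc (double j)) · stretch Q (double m ∸ suc (double j)))
        ≈⟨ +-cong (sumTo-cong′ (suc m) (λ j → *-cong refl (reflexive
                    (≡.trans (≡.cong (stretch Q) (double-∸-double m j)) (stretch-double Q (m ∸ j))))))
                  (sumTo-zero m (λ j j<m → trans (*-cong refl (reflexive
                    (≡.trans (≡.cong (stretch Q) (double-∸-suc-double j<m)) (stretch-suc-double Q (m ∸ suc j)))))
                    (zeroʳ _))) ⟩
          (evenPart h ⋆ Q) m + 0#
        ≈⟨ +-identityʳ _ ⟩
          (evenPart h ⋆ Q) m
        ∎

    oddPart-⋆-stretch : ∀ h Q → oddPart (h ⋆ stretch Q) ≐ oddPart h ⋆ Q
    oddPart-⋆-stretch h Q = ⟪ coefficient ⟫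
      where
      coefficient : ∀ m → (h ⋆ stretch Q) (suc (double m)) ≈ (oddPart h ⋆ Q) m
      coefficient m = begin
          sumTo (double (suc m)) (λ k → h k · stretch Q (suc (double m) ∸ k))
        ≈⟨ sumTo-double (suc m) _ ⟩
          sumTo (suc m) (λ j → h (double j) · stretch Q (suc (double m) ∸ double j))
            + sumTo (suc m) (λ j → h (suc (double j)) · stretch Q (double m ∸ double j))
        ≈⟨ +-cong (sumTo-zero (suc m) (λ j j≤m → trans (*-cong refl (reflexive
                    (≡.trans (≡.cong (stretch Q) (suc-double-∸-double (ℕ.≤-pred j≤m))) (stretch-suc-double Q (m ∸ j)))))
                    (zeroʳ _)))
                  (sumTo-cong′ (suc m) (λ j → *-cong refl (reflexive
                    (≡.trans (≡.cong (stretch Q) (double-∸-double m j)) (stretch-double Q (m ∸ j)))))) ⟩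
          0# + (oddPart h ⋆ Q) m
        ≈⟨ +-identityˡ _ ⟩
          (oddPart h ⋆ Q) m
        ∎

  stretch-⋆ : ∀ a b → stretch a ⋆ stretch b ≐ stretch (a ⋆ b)
  stretch-⋆ a b = ≐-trans (Even⇒stretch-evenPart ⋆-even) (stretch-cong
    (≐-trans (evenPart-⋆-stretch (stretch a) b) (⋆-congˡ b (evenPart-stretch a))))
    where
    ⋆-even : Even (stretch a ⋆ stretch b)
    ⋆-even m = trans (oddPart-⋆-stretch (stretch a) b ! m)
      (trans (⋆-congˡ {oddPart (stretch a)} b ⟪ Even-stretch a ⟫ ! m) (⋆-zeroˡ b ! m))

  stretch-zero : ∀ n → stretch zeroPS n ≈ 0#
  stretch-zero zero          = refl
  stretch-zero (suc zero)    = refl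
  stretch-zero (suc (suc n)) = stretch-zero n

  stretch-onePS : stretch onePS ≐ onePS
  stretch-onePS = ⟪ (λ { zero → refl ; (suc zero) → refl ; (suc (suc n)) → stretch-zero n }) ⟫

  stretch-pow : ∀ a k → powPS (stretch a) k ≐ stretch (powPS a k)
  stretch-pow a zero    = ≐-sym stretch-onePS
  stretch-pow a (suc k) = ≐-trans (⋆-congʳ (stretch a) (stretch-pow a k)) (stretch-⋆ a (powPS a k))

  stretch-X : stretch X ≐ X ⋆ X
  stretch-X = ⟪ coefficient ⟫
    where
    coefficient : ∀ n → stretch X n ≈ (X ⋆ X) n
    coefficient zero                      = sym (X⋆-zero X)
    coefficient (suc zero)                = sym (X⋆-suc X 0)
    coefficient (suc (suc zero))          = sym (X⋆-suc X 1)
    coefficient (suc (suc (suc zero)))    = sym (X⋆-suc X 2)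
    coefficient (suc (suc (suc (suc n)))) = trans (stretch-zero n) (sym (X⋆-suc X (suc (suc (suc n)))))

  ∘ₚ-stretch : ∀ {Φ} → Φ 0 ≈ 0# → ∀ Q → Q ∘ₚ stretch Φ ≐ stretch (Q ∘ₚ Φ)
  ∘ₚ-stretch {Φ} Φ₀≈0 Q = ≐-trans (apply-cong (λ k → stretch-pow Φ k) (≐-refl {Q})) ⟪ coefficient ⟫
    where
    coefficient : ∀ n → apply (λ k → stretch (powPS Φ k)) Q n ≈ stretch (Q ∘ₚ Φ) n
    coefficient n with parity n
    ... | even m =
      trans (sumTo-cong′ (suc (double m)) (λ k → *-cong (reflexive (stretch-double (powPS Φ k) m)) refl))
            (trans (sym (apply-extend Q (OrderAtLeast-pow₁ Φ₀≈0) (suc (double m)) m (s≤s (n≤double m))))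
                   (reflexive (≡.sym (stretch-double (Q ∘ₚ Φ) m))))
    ... | odd  m =
      trans (sumTo-zero (suc (suc (double m))) (λ k _ →
               trans (*-cong (reflexive (stretch-suc-double (powPS Φ k) m)) refl) (zeroˡ _)))
            (reflexive (≡.sym (stretch-suc-double (Q ∘ₚ Φ) m)))

  Odd⇒Even-X⋆ : ∀ {f} → Odd f → Even (X ⋆ f)
  Odd⇒Even-X⋆ {f} f-odd m =
    trans (X⋆-suc f (double m)) (trans (reflexive (≡.cong f (double≡2* m))) (f-odd m))

  Even-X⋆⇒Odd : ∀ {f} → Even (X ⋆ f) → Odd f
  Even-X⋆⇒Odd {f} Xf-even m =
    trans (reflexive (≡.cong f (≡.sym (double≡2* m)))) (trans (sym (X⋆-suc f (double m))) (Xf-even m))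

  -- Sprugnoli arrays
  xf₂ : Triple → PS
  xf₂ T = X ⋆ f₂ T

  -- For a Sprugnoli array xf₂ T is even; φ T is the series with φ T (x²) = xf₂ T.
  φ : Triple → PS
  φ T = evenPart (xf₂ T)

  column-double : ∀ T m → column T (double m) ≐ g T ⋆ powPS (xf₂ T) m
  column-double T m = ≐-trans
    (≐-reflexive (≡.cong₂ (λ i j → g T ⋆ (powPS (f₁ T) i ⋆ powPS (xf₂ T) j)) (double-%2 m) (double-/2 m)))
    (⋆-congʳ (g T) (⋆-identityˡ (powPS (xf₂ T) m)))

  column-suc-double : ∀ T m → column T (suc (double m)) ≐ g T ⋆ (f₁ T ⋆ powPS (xf₂ T) m)
  column-suc-double T m = ≐-trans
    (≐-reflexive (≡.cong₂ (λ i j → g T ⋆ (powPS (f₁ T) i ⋆ powPS (xf₂ T) j))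
                          (suc-double-%2 m) (suc-double-/2 m)))
    (⋆-congʳ (g T) (⋆-congˡ (powPS (xf₂ T) m) (⋆-identityʳ (f₁ T))))

  column-cong : ∀ {A B} → A ≋T B → ∀ k → column A k ≐ column B k
  column-cong (g≋ , f₁≋ , f₂≋) k =
    ⋆-cong ⟪ g≋ ⟫ (⋆-cong (powPS-cong (k % 2) ⟪ f₁≋ ⟫) (powPS-cong (k / 2) (⋆-congʳ X ⟪ f₂≋ ⟫)))

  act-cong : ∀ S {h h′} → h ≐ h′ → act S h ≐ act S h′
  act-cong S h≐h′ = apply-cong (λ k → ≐-refl) h≐h′

  module _ {S : Triple} (S-sprugnoli : IsSprugnoli S) where
    private
      g-InF : InF 0 (g S)
      g-InF = proj₁ S-sprugnoli
      f₁-InF : InF 1 (f₁ S)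
      f₁-InF = proj₁ (proj₂ S-sprugnoli)
      f₂-InF : InF 1 (f₂ S)
      f₂-InF = proj₁ (proj₂ (proj₂ S-sprugnoli))
      f₂-odd : Odd (f₂ S)
      f₂-odd = proj₂ (proj₂ (proj₂ S-sprugnoli))

    xf₂-InF : InF 2 (xf₂ S)
    xf₂-InF = InF-⋆ InF-X f₂-InF

    xf₂₀≈0 : xf₂ S 0 ≈ 0#
    xf₂₀≈0 = proj₁ xf₂-InF 0 (s≤s z≤n)

    xf₂≐stretch-φ : xf₂ S ≐ stretch (φ S)
    xf₂≐stretch-φ = Even⇒stretch-evenPart (Odd⇒Even-X⋆ {f₂ S} f₂-odd)

    InF-column : ∀ k → InF k (column S k)
    InF-column k with parity k
    ... | even m = ≡.subst (λ p → InF p (column S (double m))) (≡.sym (double≡*2 m))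
      (InF-cong (≐-sym (column-double S m)) (InF-⋆ g-InF (InF-pow m xf₂-InF)))
    ... | odd  m = ≡.subst (λ p → InF p (column S (suc (double m)))) (≡.sym (≡.cong suc (double≡*2 m)))
      (InF-cong (≐-sym (column-suc-double S m)) (InF-⋆ g-InF (InF-⋆ f₁-InF (InF-pow m xf₂-InF))))

    column-lower : LowerTriangular (column S)
    column-lower k = proj₁ (InF-column k)

    column-diagonal : ∀ k → ¬ (column S k k ≈ 0#)
    column-diagonal k = proj₂ (InF-column k)

    act-split : ∀ h → act S h ≐ g S ⋆ (evenPart h ∘ₚ xf₂ S ⊕ f₁ S ⋆ (oddPart h ∘ₚ xf₂ S))
    act-split h = begin
        act S h
      ≈⟨ ⟪ coefficient ⟫ ⟩
        apply evenColumn (evenPart h) ⊕ apply oddColumn (oddPart h)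
      ≈⟨ ⊕-cong (≐-sym (⋆-apply F-lower (g S) (evenPart h)))
                (≐-sym (≐-trans (⋆-congʳ (g S) (⋆-apply F-lower (f₁ S) (oddPart h)))
                                (⋆-apply (LowerTriangular-⋆ (f₁ S) F-lower) (g S) (oddPart h)))) ⟩
        g S ⋆ (evenPart h ∘ₚ F) ⊕ g S ⋆ (f₁ S ⋆ (oddPart h ∘ₚ F))
      ≈⟨ ≐-sym (⋆-distribˡ (g S) (evenPart h ∘ₚ F) (f₁ S ⋆ (oddPart h ∘ₚ F))) ⟩
        g S ⋆ (evenPart h ∘ₚ F ⊕ f₁ S ⋆ (oddPart h ∘ₚ F))
      ∎
      where
      open SetoidReasoning ≐-setoid
      F : PS
      F = xf₂ S
      F-lower : LowerTriangular (powPS F)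
      F-lower = OrderAtLeast-pow₁ xf₂₀≈0
      evenColumn oddColumn : ℕ → PS
      evenColumn m = g S ⋆ powPS F m
      oddColumn  m = g S ⋆ (f₁ S ⋆ powPS F m)
      coefficient : ∀ n → act S h n ≈ (apply evenColumn (evenPart h) ⊕ apply oddColumn (oddPart h)) n
      coefficient n = trans (apply-extend h column-lower (double (suc n)) n (n≤double (suc n)))
        (trans (sumTo-double (suc n) _)
               (+-cong (sumTo-cong′ (suc n) (λ m → *-cong (column-double S m ! n) refl))
                       (sumTo-cong′ (suc n) (λ m → *-cong (column-suc-double S m ! n) refl))))

    act-⋆-stretch : ∀ h Q → act S (h ⋆ stretch Q) ≐ (Q ∘ₚ xf₂ S) ⋆ act S h
    act-⋆-stretch h Q = begin
        act S (h ⋆ stretch Q)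
      ≈⟨ act-split (h ⋆ stretch Q) ⟩
        g S ⋆ (evenPart (h ⋆ stretch Q) ∘ₚ F ⊕ f₁ S ⋆ (oddPart (h ⋆ stretch Q) ∘ₚ F))
      ≈⟨ ⋆-congʳ (g S) (⊕-cong (∘ₚ-cong (evenPart-⋆-stretch h Q) ≐-refl)
                              (⋆-congʳ (f₁ S) (∘ₚ-cong (oddPart-⋆-stretch h Q) ≐-refl))) ⟩
        g S ⋆ ((evenPart h ⋆ Q) ∘ₚ F ⊕ f₁ S ⋆ ((oddPart h ⋆ Q) ∘ₚ F))
      ≈⟨ ⋆-congʳ (g S) (⊕-cong (≐-sym (∘ₚ-⋆ xf₂₀≈0 _ _))
                              (⋆-congʳ (f₁ S) (≐-sym (∘ₚ-⋆ xf₂₀≈0 _ _)))) ⟩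
        g S ⋆ ((evenPart h ∘ₚ F) ⋆ (Q ∘ₚ F) ⊕ f₁ S ⋆ ((oddPart h ∘ₚ F) ⋆ (Q ∘ₚ F)))
      ≈⟨ PS-Solver.solve 5 (λ a b c d e → a :* (b :* c :+ d :* (e :* c)) := c :* (a :* (b :+ d :* e)))
           ≐-refl (g S) (evenPart h ∘ₚ F) (Q ∘ₚ F) (f₁ S) (oddPart h ∘ₚ F) ⟩
        (Q ∘ₚ F) ⋆ (g S ⋆ (evenPart h ∘ₚ F ⊕ f₁ S ⋆ (oddPart h ∘ₚ F)))
      ≈⟨ ⋆-congʳ (Q ∘ₚ F) (≐-sym (act-split h)) ⟩
        (Q ∘ₚ F) ⋆ act S h
      ∎
      where
      open SetoidReasoning ≐-setoid
      open PS-Solver using (_:*_; _:+_; _:=_)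
      F : PS
      F = xf₂ S

  module _ {S T : Triple} (S-sprugnoli : IsSprugnoli S) (T-sprugnoli : IsSprugnoli T) where
    open SetoidReasoning ≐-setoid

    act-g₀≉0 : ¬ (act S (g T) 0 ≈ 0#)
    act-g₀≉0 = proj₂ (InF-apply {column S} (column-diagonal S-sprugnoli) (proj₁ T-sprugnoli))

    f₁-⊙ : act S (g T) ⋆ f₁ (S ⊙ T) ≐ act S (g T ⋆ f₁ T)
    f₁-⊙ = ⋆-divPS (act S (g T ⋆ f₁ T)) act-g₀≉0

    xf₂-⊙ : xf₂ (S ⊙ T) ≐ φ T ∘ₚ xf₂ S
    xf₂-⊙ = ≐-trans (X⋆shiftPS D D₀≈0) D≐
      where
      D : PS
      D = divPS (act S (X ⋆ (g T ⋆ f₂ T))) (act S (g T))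
      D≐ : D ≐ φ T ∘ₚ xf₂ S
      D≐ = ⋆-cancelˡ act-g₀≉0 (begin
          act S (g T) ⋆ D                  ≈⟨ ⋆-divPS _ act-g₀≉0 ⟩
          act S (X ⋆ (g T ⋆ f₂ T))         ≈⟨ act-cong S (⋆-leftComm X (g T) (f₂ T)) ⟩
          act S (g T ⋆ xf₂ T)              ≈⟨ act-cong S (⋆-congʳ (g T) (xf₂≐stretch-φ T-sprugnoli)) ⟩
          act S (g T ⋆ stretch (φ T))      ≈⟨ act-⋆-stretch S-sprugnoli (g T) (φ T) ⟩
          (φ T ∘ₚ xf₂ S) ⋆ act S (g T)     ≈⟨ ⋆-comm (φ T ∘ₚ xf₂ S) (act S (g T)) ⟩
          act S (g T) ⋆ (φ T ∘ₚ xf₂ S)     ∎)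
      D₀≈0 : D 0 ≈ 0#
      D₀≈0 = trans (D≐ ! 0) (trans (∘ₚ-constant (φ T) (xf₂ S)) (xf₂₀≈0 T-sprugnoli))

    act-⋆-pow : ∀ h m → act S (h ⋆ powPS (xf₂ T) m) ≐ act S h ⋆ powPS (xf₂ (S ⊙ T)) m
    act-⋆-pow h m = begin
        act S (h ⋆ powPS (xf₂ T) m)
      ≈⟨ act-cong S (⋆-congʳ h (≐-trans (powPS-cong m (xf₂≐stretch-φ T-sprugnoli)) (stretch-pow (φ T) m))) ⟩
        act S (h ⋆ stretch (powPS (φ T) m))
      ≈⟨ act-⋆-stretch S-sprugnoli h (powPS (φ T) m) ⟩
        (powPS (φ T) m ∘ₚ xf₂ S) ⋆ act S h
      ≈⟨ ⋆-congˡ (act S h) (≐-sym (∘ₚ-pow (xf₂₀≈0 S-sprugnoli) (φ T) m)) ⟩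
        powPS (φ T ∘ₚ xf₂ S) m ⋆ act S h
      ≈⟨ ⋆-congˡ (act S h) (powPS-cong m (≐-sym xf₂-⊙)) ⟩
        powPS (xf₂ (S ⊙ T)) m ⋆ act S h
      ≈⟨ ⋆-comm (powPS (xf₂ (S ⊙ T)) m) (act S h) ⟩
        act S h ⋆ powPS (xf₂ (S ⊙ T)) m
      ∎

    column-⊙ : ∀ k → column (S ⊙ T) k ≐ act S (column T k)
    column-⊙ k with parity k
    ... | even m = begin
        column (S ⊙ T) (double m)              ≈⟨ column-double (S ⊙ T) m ⟩
        act S (g T) ⋆ powPS (xf₂ (S ⊙ T)) m    ≈⟨ ≐-sym (act-⋆-pow (g T) m) ⟩
        act S (g T ⋆ powPS (xf₂ T) m)          ≈⟨ act-cong S (≐-sym (column-double T m)) ⟩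
        act S (column T (double m))            ∎
    ... | odd m = begin
        column (S ⊙ T) (suc (double m))
      ≈⟨ column-suc-double (S ⊙ T) m ⟩
        act S (g T) ⋆ (f₁ (S ⊙ T) ⋆ powPS (xf₂ (S ⊙ T)) m)
      ≈⟨ ≐-sym (⋆-assoc (act S (g T)) (f₁ (S ⊙ T)) (powPS (xf₂ (S ⊙ T)) m)) ⟩
        (act S (g T) ⋆ f₁ (S ⊙ T)) ⋆ powPS (xf₂ (S ⊙ T)) m
      ≈⟨ ⋆-congˡ (powPS (xf₂ (S ⊙ T)) m) f₁-⊙ ⟩
        act S (g T ⋆ f₁ T) ⋆ powPS (xf₂ (S ⊙ T)) m
      ≈⟨ ≐-sym (act-⋆-pow (g T ⋆ f₁ T) m) ⟩
        act S ((g T ⋆ f₁ T) ⋆ powPS (xf₂ T) m)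
      ≈⟨ act-cong S (≐-trans (⋆-assoc (g T) (f₁ T) (powPS (xf₂ T) m)) (≐-sym (column-suc-double T m))) ⟩
        act S (column T (suc (double m)))
      ∎

    act-⊙ : ∀ h → act (S ⊙ T) h ≐ act S (act T h)
    act-⊙ h = ≐-trans (apply-cong column-⊙ (≐-refl {h}))
                      (≐-sym (apply-apply (column S) (column-lower T-sprugnoli) h))

  -- The group laws
  g₀≉0 : ∀ {T} → IsSprugnoli T → ¬ (g T 0 ≈ 0#)
  g₀≉0 T-sprugnoli = proj₂ (proj₁ T-sprugnoli)

  IsSprugnoli-⊙ : ∀ {S T} → IsSprugnoli S → IsSprugnoli T → IsSprugnoli (S ⊙ T)
  IsSprugnoli-⊙ {S} {T} S-sprugnoli T-sprugnoli@(g-InF , f₁-InF , f₂-InF , _) =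
      InF-apply {column S} diagonal g-InF
    , InF-⋆ (InF-apply {column S} diagonal (InF-⋆ g-InF f₁-InF)) act-g⁻¹-InF
    , InF-shiftPS (InF-⋆ (InF-apply {column S} diagonal (InF-⋆ InF-X (InF-⋆ g-InF f₂-InF))) act-g⁻¹-InF)
    , Even-X⋆⇒Odd {f₂ (S ⊙ T)} (Even-cong (≐-sym xf₂≐stretch) (Even-stretch (φ T ∘ₚ φ S)))
    where
    diagonal : ∀ k → ¬ (column S k k ≈ 0#)
    diagonal = column-diagonal S-sprugnoli
    act-g⁻¹-InF : InF 0 (invPS (act S (g T)))
    act-g⁻¹-InF = InF-invPS (act-g₀≉0 S-sprugnoli T-sprugnoli)
    xf₂≐stretch : xf₂ (S ⊙ T) ≐ stretch (φ T ∘ₚ φ S)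
    xf₂≐stretch = ≐-trans (xf₂-⊙ S-sprugnoli T-sprugnoli)
      (≐-trans (∘ₚ-cong (≐-refl {φ T}) (xf₂≐stretch-φ S-sprugnoli)) (∘ₚ-stretch (xf₂₀≈0 S-sprugnoli) (φ T)))

  ≋T-from-columns : ∀ {A B} → ¬ (g A 0 ≈ 0#) → (∀ k → column A k ≐ column B k) → A ≋T B
  ≋T-from-columns {A} {B} gA₀≉0 columns≐ = (g≐ !_) , (f₁≐ !_) , (f₂≐ !_)
    where
    open SetoidReasoning ≐-setoid
    column-0 : ∀ T → column T 0 ≐ g T
    column-0 T = ≐-trans (column-double T 0) (⋆-identityʳ (g T))
    column-1 : ∀ T → column T 1 ≐ g T ⋆ f₁ T
    column-1 T = ≐-trans (column-suc-double T 0) (⋆-congʳ (g T) (⋆-identityʳ (f₁ T)))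
    column-2 : ∀ T → column T 2 ≐ g T ⋆ xf₂ T
    column-2 T = ≐-trans (column-double T 1) (⋆-congʳ (g T) (⋆-identityʳ (xf₂ T)))
    g≐ : g A ≐ g B
    g≐ = ≐-trans (≐-sym (column-0 A)) (≐-trans (columns≐ 0) (column-0 B))
    f₁≐ : f₁ A ≐ f₁ B
    f₁≐ = ⋆-cancelˡ gA₀≉0 (begin
      g A ⋆ f₁ A     ≈⟨ ≐-sym (column-1 A) ⟩
      column A 1     ≈⟨ columns≐ 1 ⟩
      column B 1     ≈⟨ column-1 B ⟩
      g B ⋆ f₁ B     ≈⟨ ⋆-congˡ (f₁ B) (≐-sym g≐) ⟩
      g A ⋆ f₁ B     ∎)
    f₂≐ : f₂ A ≐ f₂ B
    f₂≐ = X⋆-cancel (⋆-cancelˡ gA₀≉0 (begin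
      g A ⋆ xf₂ A    ≈⟨ ≐-sym (column-2 A) ⟩
      column A 2     ≈⟨ columns≐ 2 ⟩
      column B 2     ≈⟨ column-2 B ⟩
      g B ⋆ xf₂ B    ≈⟨ ⋆-congˡ (xf₂ B) (≐-sym g≐) ⟩
      g A ⋆ xf₂ B    ∎))

  ≋T-refl : ∀ {A} → A ≋T A
  ≋T-refl = (λ n → refl) , (λ n → refl) , (λ n → refl)

  ≋T-sym : ∀ {A B} → A ≋T B → B ≋T A
  ≋T-sym (g≋ , f₁≋ , f₂≋) = (λ n → sym (g≋ n)) , (λ n → sym (f₁≋ n)) , (λ n → sym (f₂≋ n))

  ≋T-trans : ∀ {A B C} → A ≋T B → B ≋T C → A ≋T C
  ≋T-trans (g≋ , f₁≋ , f₂≋) (g≋′ , f₁≋′ , f₂≋′) =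
    (λ n → trans (g≋ n) (g≋′ n)) , (λ n → trans (f₁≋ n) (f₁≋′ n)) , (λ n → trans (f₂≋ n) (f₂≋′ n))

  ≋T-setoid : Setoid c ℓ
  ≋T-setoid = record
    { Carrier = Triple ; _≈_ = _≋T_
    ; isEquivalence = record { refl = ≋T-refl ; sym = ≋T-sym ; trans = ≋T-trans } }

  column-idT : ∀ k → column idT k ≐ powPS X k
  column-idT k with parity k
  ... | even m = ≐-trans (column-double idT m) (≐-trans (⋆-identityˡ _) (powPS-double X m))
  ... | odd  m = ≐-trans (column-suc-double idT m) (≐-trans (⋆-identityˡ _) (⋆-congʳ X (powPS-double X m)))

  act-idT : ∀ h → act idT h ≐ h
  act-idT h = ≐-trans (apply-cong column-idT (≐-refl {h})) (apply-powX h)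

  IsSprugnoli-idT : IsSprugnoli idT
  IsSprugnoli-idT = InF-onePS , InF-X , InF-X , Even-X⋆⇒Odd {X} (Even-cong stretch-X (Even-stretch X))

  ⊙-identityˡ : ∀ {S} → IsSprugnoli S → (idT ⊙ S) ≋T S
  ⊙-identityˡ {S} S-sprugnoli = ≋T-from-columns (g₀≉0 (IsSprugnoli-⊙ IsSprugnoli-idT S-sprugnoli)) (λ k →
    ≐-trans (column-⊙ IsSprugnoli-idT S-sprugnoli k) (act-idT (column S k)))

  ⊙-identityʳ : ∀ {S} → IsSprugnoli S → (S ⊙ idT) ≋T S
  ⊙-identityʳ {S} S-sprugnoli = ≋T-from-columns (g₀≉0 (IsSprugnoli-⊙ S-sprugnoli IsSprugnoli-idT)) (λ k →
    ≐-trans (column-⊙ S-sprugnoli IsSprugnoli-idT k)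
            (≐-trans (act-cong S (column-idT k)) (apply-to-powX (column-lower S-sprugnoli) k)))

  ⊙-assoc : ∀ {S T U} → IsSprugnoli S → IsSprugnoli T → IsSprugnoli U → ((S ⊙ T) ⊙ U) ≋T (S ⊙ (T ⊙ U))
  ⊙-assoc {S} {T} {U} S-sprugnoli T-sprugnoli U-sprugnoli =
    ≋T-from-columns (g₀≉0 (IsSprugnoli-⊙ ST-sprugnoli U-sprugnoli)) (λ k → begin
      column ((S ⊙ T) ⊙ U) k      ≈⟨ column-⊙ ST-sprugnoli U-sprugnoli k ⟩
      act (S ⊙ T) (column U k)    ≈⟨ act-⊙ S-sprugnoli T-sprugnoli (column U k) ⟩
      act S (act T (column U k))  ≈⟨ act-cong S (≐-sym (column-⊙ T-sprugnoli U-sprugnoli k)) ⟩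
      act S (column (T ⊙ U) k)    ≈⟨ ≐-sym (column-⊙ S-sprugnoli (IsSprugnoli-⊙ T-sprugnoli U-sprugnoli) k) ⟩
      column (S ⊙ (T ⊙ U)) k      ∎)
    where
    open SetoidReasoning ≐-setoid
    ST-sprugnoli : IsSprugnoli (S ⊙ T)
    ST-sprugnoli = IsSprugnoli-⊙ S-sprugnoli T-sprugnoli

  ⊙-cong : ∀ {S S′ T T′} → IsSprugnoli S → IsSprugnoli S′ → IsSprugnoli T → IsSprugnoli T′ →
    S ≋T S′ → T ≋T T′ → (S ⊙ T) ≋T (S′ ⊙ T′)
  ⊙-cong {S} {S′} {T} {T′} S-sprugnoli S′-sprugnoli T-sprugnoli T′-sprugnoli S≋S′ T≋T′ =
    ≋T-from-columns (g₀≉0 (IsSprugnoli-⊙ S-sprugnoli T-sprugnoli)) (λ k → begin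
      column (S ⊙ T) k            ≈⟨ column-⊙ S-sprugnoli T-sprugnoli k ⟩
      act S (column T k)          ≈⟨ apply-cong (column-cong S≋S′) (column-cong T≋T′ k) ⟩
      act S′ (column T′ k)        ≈⟨ ≐-sym (column-⊙ S′-sprugnoli T′-sprugnoli k) ⟩
      column (S′ ⊙ T′) k          ∎)
    where open SetoidReasoning ≐-setoid

  rightInverse : ∀ {S} → IsSprugnoli S → Σ Triple (λ T → IsSprugnoli T × (S ⊙ T) ≋T idT)
  rightInverse {S} S-sprugnoli = T , T-sprugnoli , (u-solves !_) , (f₁≐X !_) , (f₂≐X !_)
    where
    open SetoidReasoning ≐-setoid
    diagonal : ∀ k → ¬ (column S k k ≈ 0#)
    diagonal = column-diagonal S-sprugnoli
    φ-InF : InF 1 (φ S)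
    φ-InF = (λ { zero _ → xf₂₀≈0 S-sprugnoli ; (suc j) (s≤s ()) }) , proj₂ (xf₂-InF S-sprugnoli)
    φ-diagonal : ∀ k → ¬ (powPS (φ S) k k ≈ 0#)
    φ-diagonal k = proj₂ (≡.subst (λ p → InF p (powPS (φ S) k)) (ℕ.*-identityʳ k) (InF-pow k φ-InF))

    u w E : PS
    u = proj₁ (apply-surjective diagonal onePS)
    w = proj₁ (apply-surjective diagonal X)
    E = proj₁ (apply-surjective φ-diagonal X)
    u-solves : act S u ≐ onePS
    u-solves = proj₂ (apply-surjective diagonal onePS)
    w-solves : act S w ≐ X
    w-solves = proj₂ (apply-surjective diagonal X)
    E-solves : E ∘ₚ φ S ≐ X
    E-solves = proj₂ (apply-surjective φ-diagonal X)

    u-InF : InF 0 u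
    u-InF = InF-apply⁻¹ {column S} diagonal (InF-cong (≐-sym u-solves) InF-onePS)
    w-InF : InF 1 w
    w-InF = InF-apply⁻¹ {column S} diagonal (InF-cong (≐-sym w-solves) InF-X)
    E-InF : InF 1 E
    E-InF = InF-apply⁻¹ {powPS (φ S)} φ-diagonal (InF-cong (≐-sym E-solves) InF-X)

    T : Triple
    T = ⟨ u , divPS w u , shiftPS (stretch E) ⟩

    xf₂≐stretch-E : xf₂ T ≐ stretch E
    xf₂≐stretch-E = X⋆shiftPS (stretch E) (proj₁ E-InF 0 (s≤s z≤n))

    T-sprugnoli : IsSprugnoli T
    T-sprugnoli = u-InF
                , InF-⋆ w-InF (InF-invPS (proj₂ u-InF))
                , ((λ { zero _ → refl ; (suc j) (s≤s ()) }) , proj₂ E-InF)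
                , Even-X⋆⇒Odd {f₂ T} (Even-cong (≐-sym xf₂≐stretch-E) (Even-stretch E))

    f₁≐X : f₁ (S ⊙ T) ≐ X
    f₁≐X = begin
      f₁ (S ⊙ T)                 ≈⟨ ≐-sym (⋆-identityˡ (f₁ (S ⊙ T))) ⟩
      onePS ⋆ f₁ (S ⊙ T)         ≈⟨ ⋆-congˡ (f₁ (S ⊙ T)) (≐-sym u-solves) ⟩
      act S u ⋆ f₁ (S ⊙ T)       ≈⟨ f₁-⊙ S-sprugnoli T-sprugnoli ⟩
      act S (u ⋆ divPS w u)      ≈⟨ act-cong S (⋆-divPS w (proj₂ u-InF)) ⟩
      act S w                    ≈⟨ w-solves ⟩
      X                          ∎

    f₂≐X : f₂ (S ⊙ T) ≐ X
    f₂≐X = X⋆-cancel (begin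
      xf₂ (S ⊙ T)                ≈⟨ xf₂-⊙ S-sprugnoli T-sprugnoli ⟩
      φ T ∘ₚ xf₂ S               ≈⟨ ∘ₚ-cong ⟪ (λ m → xf₂≐stretch-E ! double m) ⟫ (xf₂≐stretch-φ S-sprugnoli) ⟩
      evenPart (stretch E) ∘ₚ stretch (φ S)
                                 ≈⟨ ∘ₚ-cong (evenPart-stretch E) (≐-refl {stretch (φ S)}) ⟩
      E ∘ₚ stretch (φ S)         ≈⟨ ∘ₚ-stretch (xf₂₀≈0 S-sprugnoli) E ⟩
      stretch (E ∘ₚ φ S)         ≈⟨ stretch-cong E-solves ⟩
      stretch X                  ≈⟨ stretch-X ⟩
      X ⋆ X                      ∎)

  rightInverse⇒leftInverse : ∀ {S T T′} → IsSprugnoli S → IsSprugnoli T → IsSprugnoli T′ →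
    (S ⊙ T) ≋T idT → (T ⊙ T′) ≋T idT → (T ⊙ S) ≋T idT
  rightInverse⇒leftInverse {S} {T} {T′} S-sprugnoli T-sprugnoli T′-sprugnoli ST≋idT TT′≋idT =
    ≋T-trans (⊙-cong T-sprugnoli T-sprugnoli S-sprugnoli T′-sprugnoli ≋T-refl S≋T′) TT′≋idT
    where
    open SetoidReasoning ≋T-setoid
    S≋T′ : S ≋T T′
    S≋T′ = begin
      S              ≈⟨ ≋T-sym (⊙-identityʳ S-sprugnoli) ⟩
      S ⊙ idT        ≈⟨ ⊙-cong S-sprugnoli S-sprugnoli IsSprugnoli-idT
                               (IsSprugnoli-⊙ T-sprugnoli T′-sprugnoli) ≋T-refl (≋T-sym TT′≋idT) ⟩
      S ⊙ (T ⊙ T′)   ≈⟨ ≋T-sym (⊙-assoc S-sprugnoli T-sprugnoli T′-sprugnoli) ⟩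
      (S ⊙ T) ⊙ T′   ≈⟨ ⊙-cong (IsSprugnoli-⊙ S-sprugnoli T-sprugnoli) IsSprugnoli-idT
                               T′-sprugnoli T′-sprugnoli ST≋idT ≋T-refl ⟩
      idT ⊙ T′       ≈⟨ ⊙-identityˡ T′-sprugnoli ⟩
      T′             ∎

  inverse : ∀ {S} → IsSprugnoli S →
    Σ Triple (λ T → IsSprugnoli T × ((S ⊙ T) ≋T idT) × ((T ⊙ S) ≋T idT))
  inverse {S} S-sprugnoli = twoSided (rightInverse S-sprugnoli)
    -- The right inverses are taken apart in helper functions: abstracting them with `with` makes
    -- type checking blow up.
    where
    twoSided : Σ Triple (λ T → IsSprugnoli T × (S ⊙ T) ≋T idT) →
      Σ Triple (λ T → IsSprugnoli T × ((S ⊙ T) ≋T idT) × ((T ⊙ S) ≋T idT))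
    twoSided (T , T-sprugnoli , ST≋idT) = T , T-sprugnoli , ST≋idT , leftInverse (rightInverse T-sprugnoli)
      where
      leftInverse : Σ Triple (λ T′ → IsSprugnoli T′ × (T ⊙ T′) ≋T idT) → (T ⊙ S) ≋T idT
      leftInverse (T′ , T′-sprugnoli , TT′≋idT) =
        rightInverse⇒leftInverse S-sprugnoli T-sprugnoli T′-sprugnoli ST≋idT TT′≋idT

mainTheorem1 : ∀ {c ℓ} (K : Field c ℓ) → CharZero K →
    let open Sprugnoli K in
    (∀ S T → IsSprugnoli S → IsSprugnoli T → IsSprugnoli (S ⊙ T))
    × IsSprugnoli idT
    × (∀ S → IsSprugnoli S → (idT ⊙ S) ≋T S)
    × (∀ S → IsSprugnoli S → (S ⊙ idT) ≋T S)
    × (∀ S T U → IsSprugnoli S → IsSprugnoli T → IsSprugnoli U →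
         ((S ⊙ T) ⊙ U) ≋T (S ⊙ (T ⊙ U)))
    × (∀ S → IsSprugnoli S →
         Σ Triple (λ T → IsSprugnoli T × ((S ⊙ T) ≋T idT) × ((T ⊙ S) ≋T idT)))
mainTheorem1 K _ =
    (λ S T → IsSprugnoli-⊙)
  , IsSprugnoli-idT
  , (λ S → ⊙-identityˡ)
  , (λ S → ⊙-identityʳ)
  , (λ S T U → ⊙-assoc)
  , (λ S → inverse)
  where open SprugnoliGroup K
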